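{- The satisfaction system $\Lambda_X$ of the NeXt fragment of LTL is reception-compatible but not eviction-compatible.
   Context: Fix a non-empty set $\mathcal{P}$ of propositional atoms. $\Lambda_X=(\mathcal{L}_X,\mathfrak{M}_X,\models_X)$, where $\mathcal{L}_X$ is given by $\varphi::=p\mid X\varphi$ with $p\in\mathcal{P}$ (so every formula is $X^np$, $n\ge0$). A Kripke structure is $M=(S,R,\lambda)$ with $S$ a non-empty finite set of states, $R\subseteq S\times S$ total (every state has a successor), $\lambda:S\to\mathcal{P}(\mathcal{P})$. $\mathfrak{M}_X$ is the set of pairs $(M,s)$ with $M$ a Kripke structure and $s$ a state of $M$. $(M,s)\models_X X^ip$ iff for every path $s_0s_1\ldots$ in $M$ with $s_0=s$, $p\in\lambda(s_i)$; $(M,s)\models_X B$ iff it satisfies every formula in $B$. For a satisfaction system $\Lambda=(\mathcal{L},\mathfrak{M},\models)$: $\mathrm{Mod}(B)=\{m\in\mathfrak{M}\mid m\models B\}$; $\mathrm{FR}(\Lambda)=\{\mathrm{Mod}(B)\mid B\subseteq\mathcal{L}$ finite$\}$; $\mathrm{FRsubs}(\mathbb{M},\Lambda)$ is the set of $\subseteq$-maximal elements of $\{Y\in\mathrm{FR}(\Lambda)\mid Y\subseteq\mathbb{M}\}$ and $\mathrm{FRsups}(\mathbb{M},\Lambda)$ the set of $\subseteq$-minimal elements of $\{Y\in\mathrm{FR}(\Lambda)\mid\mathbb{M}\subseteq Y\}$. $\Lambda$ is eviction-compatible if $\mathrm{FRsubs}(\mathrm{Mod}(B)\setminus\mathbb{M},\Lambda)\neq\emptyset$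 for all finite $B\subseteq\mathcal{L}$ and $\mathbb{M}\subseteq\mathfrak{M}$; it is reception-compatible if $\mathrm{FRsups}(\mathrm{Mod}(B)\cup\mathbb{M},\Lambda)\neq\emptyset$ for all finite $B$ and $\mathbb{M}$. -}

module Defs where

open import Level using (Level; 0ℓ) renaming (suc to lsuc)
open import Data.Nat using (ℕ; zero; suc)
open import Data.Fin using (Fin)
open import Data.Product using (Σ; ∃; _×_; _,_)
open import Data.List using (List)
open import Data.List.Relation.Unary.All using (All)
open import Relation.Binary.PropositionalEquality using (_≡_)
open import Relation.Binary using (Rel)
open import Relation.Unary using (Pred; _⊆_; _≐_; _∪_; _∩_; ∁)

record SatSystem : Set₂ where
  field
    Lang : Set
    Mdl  : Set₁
    _⊨_  : Mdl → Lang → Set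

module _ (Λ : SatSystem) where
  open SatSystem Λ

  Mod : List Lang → Pred Mdl 0ℓ
  Mod B m = All (m ⊨_) B

  FR : Pred (Pred Mdl 0ℓ) (lsuc 0ℓ)
  FR Y = Σ (List Lang) λ B → Y ≐ Mod B

  FRsubs : Pred Mdl 0ℓ → Pred (Pred Mdl 0ℓ) (lsuc 0ℓ)
  FRsubs 𝕄 Y = FR Y × Y ⊆ 𝕄 ×
    ((Y′ : Pred Mdl 0ℓ) → FR Y′ → Y′ ⊆ 𝕄 → Y ⊆ Y′ → Y′ ⊆ Y)

  FRsups : Pred Mdl 0ℓ → Pred (Pred Mdl 0ℓ) (lsuc 0ℓ)
  FRsups 𝕄 Y = FR Y × 𝕄 ⊆ Y ×
    ((Y′ : Pred Mdl 0ℓ) → FR Y′ → 𝕄 ⊆ Y′ → Y′ ⊆ Y → Y ⊆ Y′)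

  EvictionCompatible : Set₁
  EvictionCompatible = (B : List Lang) (𝕄 : Pred Mdl 0ℓ) →
    ∃ λ Y → FRsubs (Mod B ∩ ∁ 𝕄) Y

  ReceptionCompatible : Set₁
  ReceptionCompatible = (B : List Lang) (𝕄 : Pred Mdl 0ℓ) →
    ∃ λ Y → FRsups (Mod B ∪ 𝕄) Y

module NeXt (P : Set) where

  data Fml : Set where
    atom : P → Fml
    X    : Fml → Fml

  record Kripke : Set₁ where
    field
      n     : ℕ
      R     : Rel (Fin (suc n)) 0ℓ
      total : ∀ s → ∃ λ t → R s t
      label : Fin (suc n) → Pred P 0ℓ

    State : Set
    State = Fin (suc n)

    record Path (s : State) : Set where
      field
        π     : ℕ → State
        start : π 0 ≡ s
        step  : ∀ i → R (π i) (π (suc i))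

  open Kripke public

  record PModel : Set₁ where
    constructor _,_
    field
      K : Kripke
      s : State K

  satAt : (K : Kripke) → (ℕ → State K) → ℕ → Fml → Set
  satAt K π k (atom p) = label K (π k) p
  satAt K π k (X φ)    = satAt K π (suc k) φ

  _⊨X_ : PModel → Fml → Set
  (K , s) ⊨X φ = (ρ : Path K s) → satAt K (Path.π ρ) 0 φ

  ΛX : SatSystem
  ΛX = record { Lang = Fml ; Mdl = PModel ; _⊨_ = _⊨X_ }

{-# OPTIONS --safe #-}
-- In Λ_X a formula X^i p holds at (M, s) iff p labels the i-th state of
-- every path from s. A finite set B of formulas is therefore satisfied by a
-- chain model whose j-th state is labelled by {q ∣ X^j q ∈ B}, and a long
-- enough chain satisfies no formula outside B: every finite theory is closed
-- under consequence. Reception then holds because the formulas of B valid on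
-- all of 𝕄 axiomatise the least finitely representable class containing
-- Mod B ∪ 𝕄 (selecting them is where excluded middle enters). Eviction fails
-- because a one-state model labelled by every atom satisfies every formula, so
-- no finitely representable class lies inside Mod ∅ ∖ 𝔐 = ∅.
module Submission where

open import Defs
open import Level using (0ℓ) renaming (suc to lsuc)
open import Relation.Nullary using (¬_)
open import Data.Product using (_×_)
open import Axiom.ExcludedMiddle using (ExcludedMiddle)

open import Data.Product using (∃; _,_; proj₂)
open import Data.Sum using (inj₁; inj₂)
open import Data.Unit using (⊤; tt)
open import Data.Nat using (ℕ; zero; suc; _+_; _⊓_; _≤_; s≤s)
open import Data.Nat.Properties
  using (+-suc; +-identityʳ; ⊓-assoc; m≥n⇒m⊓n≡n; n≤1+n; m≤n⇒m⊓n≡m; m⊓n≤n)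
open import Data.Fin as Fin using (toℕ; fromℕ<)
open import Data.Fin.Properties using (toℕ-fromℕ<)
open import Data.List using (List; []; _∷_; map; filter)
open import Data.List.Extrema.Nat using (max; xs≤max)
open import Data.List.Relation.Unary.All as All using (All; []; _∷_)
open import Data.List.Relation.Unary.All.Properties using (all-filter; filter⁺; map⁻)
open import Data.List.Membership.Propositional using (_∈_)
open import Data.List.Membership.Propositional.Properties using (∈-filter⁺)
open import Function using (id; _⇔_; mk⇔; Equivalence)
open import Relation.Unary using (Pred; _⊆_; _∪_; Decidable)
open import Relation.Binary.PropositionalEquality
  using (_≡_; refl; sym; trans; cong; subst; module ≡-Reasoning)

module _ (Λ : SatSystem) where
  open SatSystem Λ

  ConsequenceClosed : Set₁
  ConsequenceClosed = ∀ B ψ → Mod Λ B ⊆ (_⊨ ψ) → ψ ∈ B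

  ConsequenceClosed⇒ReceptionCompatible :
    ExcludedMiddle (lsuc 0ℓ) → ConsequenceClosed → ReceptionCompatible Λ
  ConsequenceClosed⇒ReceptionCompatible em closed B 𝕄 =
    Mod Λ C , (C , id , id) , Mod-B∪𝕄⊆Mod-C , Mod-C-minimal
    where
    ValidOn𝕄 : Pred Lang (lsuc 0ℓ)
    ValidOn𝕄 ψ = 𝕄 ⊆ (_⊨ ψ)

    validOn𝕄? : Decidable ValidOn𝕄
    validOn𝕄? _ = em

    C : List Lang
    C = filter validOn𝕄? B

    Mod-B∪𝕄⊆Mod-C : Mod Λ B ∪ 𝕄 ⊆ Mod Λ C
    Mod-B∪𝕄⊆Mod-C (inj₁ m⊨B) = filter⁺ validOn𝕄? m⊨B
    Mod-B∪𝕄⊆Mod-C (inj₂ m∈𝕄) = All.map (λ valid → valid m∈𝕄) (all-filter validOn𝕄? B)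

    Mod-C-minimal : (Y : Pred Mdl 0ℓ) → FR Λ Y →
      Mod Λ B ∪ 𝕄 ⊆ Y → Y ⊆ Mod Λ C → Mod Λ C ⊆ Y
    -- Each ψ ∈ B′ is a consequence of B, hence in B, and valid on 𝕄, hence in C.
    Mod-C-minimal Y (B′ , Y⊆Mod-B′ , Mod-B′⊆Y) B∪𝕄⊆Y _ m⊨C =
      Mod-B′⊆Y (All.tabulate λ ψ∈B′ →
        All.lookup m⊨C (∈-filter⁺ validOn𝕄?
          (closed B _ λ m⊨B → All.lookup (Y⊆Mod-B′ (B∪𝕄⊆Y (inj₁ m⊨B))) ψ∈B′)
          (λ m∈𝕄 → All.lookup (Y⊆Mod-B′ (B∪𝕄⊆Y (inj₂ m∈𝕄))) ψ∈B′)))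

  universalModel⇒¬EvictionCompatible :
    (∃ λ m → ∀ φ → m ⊨ φ) → ¬ EvictionCompatible Λ
  universalModel⇒¬EvictionCompatible (m , m⊨all) evict
    with evict [] (λ _ → ⊤)
  ... | _ , (B′ , _ , Mod-B′⊆Y) , Y⊆∅ , _ =
    proj₂ (Y⊆∅ (Mod-B′⊆Y (All.tabulate λ {φ} _ → m⊨all φ))) tt

⊓-suc-absorb : ∀ i N → suc (i ⊓ N) ⊓ N ≡ suc i ⊓ N
⊓-suc-absorb i N = begin
  (suc i ⊓ suc N) ⊓ N  ≡⟨ ⊓-assoc (suc i) (suc N) N ⟩
  suc i ⊓ (suc N ⊓ N)  ≡⟨ cong (suc i ⊓_) (m≥n⇒m⊓n≡n (n≤1+n N)) ⟩
  suc i ⊓ N            ∎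
  where open ≡-Reasoning

module _ (P : Set) where
  open NeXt P

  Xⁿ : ℕ → P → Fml
  Xⁿ zero    q = atom q
  Xⁿ (suc j) q = X (Xⁿ j q)

  depth : Fml → ℕ
  depth (atom _) = 0
  depth (X φ)    = suc (depth φ)

  atomOf : Fml → P
  atomOf (atom q) = q
  atomOf (X φ)    = atomOf φ

  Xⁿ-depth-atomOf : ∀ φ → Xⁿ (depth φ) (atomOf φ) ≡ φ
  Xⁿ-depth-atomOf (atom q) = refl
  Xⁿ-depth-atomOf (X φ)    = cong X (Xⁿ-depth-atomOf φ)

  satAt≡label : (K : Kripke) (π : ℕ → State K) (k : ℕ) (φ : Fml) →
    satAt K π k φ ≡ label K (π (k + depth φ)) (atomOf φ)
  satAt≡label K π k (atom q) = cong (λ i → label K (π i) q) (sym (+-identityʳ k))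
  satAt≡label K π k (X φ)    =
    trans (satAt≡label K π (suc k) φ)
          (cong (λ i → label K (π i) (atomOf φ)) (sym (+-suc k (depth φ))))

  -- States 0, 1, …, N with i → i + 1 and a loop at N; state j is labelled by L j.
  chain : ℕ → (ℕ → Pred P 0ℓ) → Kripke
  chain N L = record
    { n     = N
    ; R     = λ s t → toℕ t ≡ suc (toℕ s) ⊓ N
    ; total = λ s → fromℕ< (s≤s (m⊓n≤n (suc (toℕ s)) N)) , toℕ-fromℕ< _
    ; label = λ s → L (toℕ s)
    }

  module _ {N : ℕ} {L : ℕ → Pred P 0ℓ} where
    open Path

    chain-path-position : (ρ : Path (chain N L) Fin.zero) →
      ∀ i → toℕ (π ρ i) ≡ i ⊓ N
    chain-path-position ρ zero    = cong toℕ (start ρ)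
    chain-path-position ρ (suc i) = begin
      toℕ (π ρ (suc i))      ≡⟨ step ρ i ⟩
      suc (toℕ (π ρ i)) ⊓ N  ≡⟨ cong (λ j → suc j ⊓ N) (chain-path-position ρ i) ⟩
      suc (i ⊓ N) ⊓ N        ≡⟨ ⊓-suc-absorb i N ⟩
      suc i ⊓ N              ∎
      where open ≡-Reasoning

    chain-path : Path (chain N L) Fin.zero
    chain-path = record
      { π     = λ i → fromℕ< (s≤s (m⊓n≤n i N))
      ; start = refl
      ; step  = λ i → trans (toℕ-fromℕ< _)
          (trans (sym (⊓-suc-absorb i N))
                 (cong (λ j → suc j ⊓ N) (sym (toℕ-fromℕ< _))))
      }

    chain-⊨X : ∀ {φ} → depth φ ≤ N →
      (chain N L , Fin.zero) ⊨X φ ⇔ L (depth φ) (atomOf φ)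
    chain-⊨X {φ} φ≤N =
      mk⇔ (λ ⊨φ → subst id (along chain-path) (⊨φ chain-path))
          (λ Lφ ρ → subst id (sym (along ρ)) Lφ)
      where
      along : (ρ : Path (chain N L) Fin.zero) →
        satAt (chain N L) (π ρ) 0 φ ≡ L (depth φ) (atomOf φ)
      along ρ = trans (satAt≡label (chain N L) (π ρ) 0 φ)
        (cong (λ j → L j (atomOf φ))
              (trans (chain-path-position ρ (depth φ)) (m≤n⇒m⊓n≡m φ≤N)))

  depthLabels : List Fml → ℕ → Pred P 0ℓ
  depthLabels B j q = Xⁿ j q ∈ B

  canonical : List Fml → ℕ → Kripke
  canonical B N = chain N (depthLabels B)

  canonical-⊨B : ∀ {B N} → All (λ χ → depth χ ≤ N) B →
    Mod ΛX B (canonical B N , Fin.zero)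
  canonical-⊨B {B} B≤N = All.tabulate λ {χ} χ∈B →
    Equivalence.from (chain-⊨X {L = depthLabels B} (All.lookup B≤N χ∈B))
      (subst (_∈ B) (sym (Xⁿ-depth-atomOf χ)) χ∈B)

  ΛX-consequenceClosed : ConsequenceClosed ΛX
  ΛX-consequenceClosed B ψ Mod-B⊆ψ with map⁻ (xs≤max 0 (map depth (ψ ∷ B)))
  ... | ψ≤N ∷ B≤N =
    subst (_∈ B) (Xⁿ-depth-atomOf ψ)
      (Equivalence.to (chain-⊨X {L = depthLabels B} ψ≤N) (Mod-B⊆ψ (canonical-⊨B B≤N)))

  saturated : Kripke
  saturated = record { n = 0 ; R = λ _ _ → ⊤ ; total = λ s → s , tt ; label = λ _ _ → ⊤ }

  saturated-satAt : ∀ π k φ → satAt saturated π k φ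
  saturated-satAt π k (atom q) = tt
  saturated-satAt π k (X φ)    = saturated-satAt π (suc k) φ

  saturated-⊨X : ∀ φ → (saturated , Fin.zero) ⊨X φ
  saturated-⊨X φ ρ = saturated-satAt (Path.π ρ) 0 φ

theorem8 : ExcludedMiddle (lsuc 0ℓ) → (P : Set) → (p₀ : P) →
    ReceptionCompatible (NeXt.ΛX P) × ¬ EvictionCompatible (NeXt.ΛX P)
theorem8 em P _ =
  ConsequenceClosed⇒ReceptionCompatible (NeXt.ΛX P) em (ΛX-consequenceClosed P) ,
  universalModel⇒¬EvictionCompatible (NeXt.ΛX P) (_ , saturated-⊨X P)
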